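{- For any $F\in\mathbf{FACTOR}_3^{\cdot,2}$, $\pi_{\cdot}(F)=0$.
   Context: For $p\in[0,1]$, $\mu>0$, an $n$-vertex $3$-graph $H=(V,E)$ is an $(n,p,\mu,\cdot)$ $3$-graph if for all $X_1,X_2,X_3\subseteq V$ the number of $(x_1,x_2,x_3)\in X_1\times X_2\times X_3$ with $\{x_1,x_2,x_3\}\in E$ is at least $p|X_1||X_2||X_3|-\mu n^3$. $\delta_2(H)$ is the minimum number of edges containing a pair of vertices. $\mathbf{FACTOR}_3^{\cdot,2}$ is the class of $3$-graphs $F$ such that for all $0<p,\alpha<1$ there are $n_0\in\mathbb N$ and $\mu>0$ so that every $(n,p,\mu,\cdot)$ $3$-graph $H$ with $\delta_2(H)\ge\alpha n$, $n\ge n_0$ and $v(F)\mid n$ has an $F$-factor (vertex-disjoint copies of $F$ covering $V(H)$). $\pi_{\cdot}(F)=\sup\{p\in[0,1]:$ for every $\mu>0$ and $n_0\in\mathbb N$ there exists an $F$-free $(n,p,\mu,\cdot)$ $3$-graph with $n\ge n_0\}$.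
   Formalization: The parameters p, α and μ are rational, including the values p over which the supremum defining $\pi_{\cdot}(F)$ is taken. -}

module Defs where

open import Data.Nat as ℕ using (ℕ; zero; suc; _^_)
open import Data.Nat.Divisibility using (_∣_)
open import Data.Integer using (+_)
open import Data.Rational using (ℚ; _/_; _*_; _-_; _≤_; _<_; 0ℚ; 1ℚ)
open import Data.Fin using (Fin; zero; suc)
open import Data.Fin.Subset using (Subset; _∈_; ∣_∣)
open import Data.Bool using (Bool; true; false; if_then_else_)
open import Data.Vec using (lookup)
open import Data.Product using (Σ; _×_; _,_; ∃)
open import Relation.Binary.PropositionalEquality using (_≡_; _≢_)
open import Function.Definitions using (Injective; Surjective)
open import Relation.Nullary using (¬_)

ℕtoℚ : ℕ → ℚ
ℕtoℚ n = (+ n) / 1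

ΣFin : (n : ℕ) → (Fin n → ℕ) → ℕ
ΣFin zero    f = 0
ΣFin (suc n) f = f zero ℕ.+ ΣFin n (λ i → f (suc i))

countFin : (n : ℕ) → (Fin n → Bool) → ℕ
countFin n P = ΣFin n (λ i → if P i then 1 else 0)

-- a 3-graph on vertex set Fin n: edges are 3-element sets {x,y,z},
-- encoded by a symmetric Boolean predicate on ordered triples which is
-- false unless x, y, z are pairwise distinct.
record ThreeGraph (n : ℕ) : Set where
  field
    edge     : Fin n → Fin n → Fin n → Bool
    sym₁₂    : ∀ x y z → edge x y z ≡ edge y x z
    sym₂₃    : ∀ x y z → edge x y z ≡ edge x z y
    distinct : ∀ x y z → edge x y z ≡ true → (x ≢ y) × (y ≢ z) × (x ≢ z)
open ThreeGraph public

tripleCount : {n : ℕ} → ThreeGraph n → Subset n → Subset n → Subset n → ℕ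
tripleCount {n} H X₁ X₂ X₃ =
  ΣFin n λ x → ΣFin n λ y → countFin n λ z →
    if lookup X₁ x then (if lookup X₂ y then (if lookup X₃ z then edge H x y z else false) else false) else false

IsDense : {n : ℕ} → ThreeGraph n → ℚ → ℚ → Set
IsDense {n} H p μ = ∀ (X₁ X₂ X₃ : Subset n) →
  p * ℕtoℚ ∣ X₁ ∣ * ℕtoℚ ∣ X₂ ∣ * ℕtoℚ ∣ X₃ ∣ - μ * ℕtoℚ (n ^ 3)
    ≤ ℕtoℚ (tripleCount H X₁ X₂ X₃)

codeg : {n : ℕ} → ThreeGraph n → Fin n → Fin n → ℕ
codeg {n} H u v = countFin n (λ w → edge H u v w)

MinCodegAtLeast : {n : ℕ} → ThreeGraph n → ℚ → Set
MinCodegAtLeast {n} H α = ∀ (u v : Fin n) → u ≢ v → α * ℕtoℚ n ≤ ℕtoℚ (codeg H u v)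

IsEmbedding : {k n : ℕ} → ThreeGraph k → ThreeGraph n → (Fin k → Fin n) → Set
IsEmbedding F H φ = Injective _≡_ _≡_ φ ×
  (∀ x y z → edge F x y z ≡ true → edge H (φ x) (φ y) (φ z) ≡ true)

Contains : {k n : ℕ} → ThreeGraph k → ThreeGraph n → Set
Contains F H = ∃ λ φ → IsEmbedding F H φ

FFree : {k n : ℕ} → ThreeGraph k → ThreeGraph n → Set
FFree F H = ¬ Contains F H

HasFactor : {k n : ℕ} → ThreeGraph k → ThreeGraph n → Set
HasFactor {k} {n} F H = Σ ℕ λ m → Σ (Fin m → Fin k → Fin n) λ φ →
  (∀ i → IsEmbedding F H (φ i)) ×
  (∀ i j i′ j′ → φ i j ≡ φ i′ j′ → (i ≡ i′) × (j ≡ j′)) ×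
  (∀ v → Σ (Fin m) λ i → Σ (Fin k) λ j → φ i j ≡ v)

InFACTOR : {k : ℕ} → ThreeGraph k → Set
InFACTOR {k} F = ∀ (p α : ℚ) → 0ℚ < p → p < 1ℚ → 0ℚ < α → α < 1ℚ →
  Σ ℕ λ n₀ → Σ ℚ λ μ → 0ℚ < μ ×
    (∀ (n : ℕ) (H : ThreeGraph n) → IsDense H p μ → MinCodegAtLeast H α →
       n₀ ℕ.≤ n → k ∣ n → HasFactor F H)

-- p belongs to the set whose supremum defines π_·(F)
InPiSet : {k : ℕ} → ThreeGraph k → ℚ → Set
InPiSet F p = 0ℚ ≤ p × p ≤ 1ℚ ×
  (∀ (μ : ℚ) → 0ℚ < μ → ∀ (n₀ : ℕ) →
     Σ ℕ λ n → Σ (ThreeGraph n) λ H → FFree F H × IsDense H p μ × n₀ ℕ.≤ n)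

-- π_·(F) = 0 : every element of the (downward-closed) set is ≤ 0
PiZero : {k : ℕ} → ThreeGraph k → Set
PiZero F = ∀ (p : ℚ) → InPiSet F p → p ≤ 0ℚ

-- Suppose 0 < p and let H₀ be an F-free (n, p, μ, ·) 3-graph with μ small and n large.  Add a
-- set A of new vertices and make every triple of distinct vertices meeting A an edge.  The
-- padded graph on N = n + |A| vertices is still (p/2)-dense, since the new triples can only help
-- up to the O(N²) degenerate ones, and every pair has codegree at least |A| − 2 ≥ N/(2k).  As H₀
-- is F-free, every copy of F meets A, so an F-factor has at most |A| copies and covers at most
-- k|A| < N vertices; choosing |A| with k ∣ N contradicts F ∈ FACTOR.  When k ≤ 1 every nonempty
-- graph contains F, so no density is attainable at all.

module Submission where

open import Data.Nat using (ℕ)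
open import Defs

import Data.Bool as Bool
open import Data.Bool using (Bool; true; false; if_then_else_; not; _∧_; _∨_)
open import Data.Bool.Properties using (∨-comm; ∨-assoc; ∧-zeroʳ; ¬-not)
open import Data.Empty using (⊥-elim)
open import Function using (case_of_)
open import Data.Fin as Fin using (Fin; zero; suc; _↑ˡ_; _↑ʳ_; splitAt)
open import Data.Fin.Properties
  using (_≟_; splitAt-↑ˡ; splitAt-↑ʳ; splitAt⁻¹-↑ˡ; splitAt⁻¹-↑ʳ; combine-injective; injective⇒≤; ¬Fin0; ¬∀⟶∃¬)
open import Data.Fin.Subset using (Subset; ∣_∣)
open import Data.Maybe using (is-just)
import Data.Nat as ℕ
open import Data.Nat using (zero; suc)
import Data.Nat.Properties as ℕ
open import Algebra.Properties.CommutativeSemigroup ℕ.+-commutativeSemigroup using (interchange)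
open import Data.Product using (∃; _×_; _,_; proj₁; proj₂; map₂)
import Data.Rational as ℚ
import Data.Rational.Properties as ℚ
open import Data.Sum using (_⊎_; inj₁; inj₂; isInj₁)
open import Data.Sum.Properties using (inj₁-injective)
open import Data.Vec using ([]; _∷_; lookup; tabulate)
open import Data.Vec.Properties using (lookup∘tabulate)
open import Relation.Binary.PropositionalEquality
open import Relation.Nullary using (does; yes; no; ¬_; contradiction)
open import Relation.Nullary.Decidable using (dec-true; dec-false)

module RationalArithmetic where

  open import Data.Integer as ℤ using (+_; +[1+_]; -[1+_])
  import Data.Integer.Properties as ℤ
  import Data.Nat.Coprimality as Coprimality
  open import Data.Rational
    using (ℚ; mkℚ; toℚᵘ; _+_; _*_; _-_; -_; _≤_; _<_; 0ℚ; 1ℚ; ½; *≤*; *<*; NonNegative; nonNegative; positive)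
  open import Data.Rational.Properties
  open import Data.Rational.Unnormalised as ℚᵘ using (ℚᵘ; mkℚᵘ; _≃_)
  import Data.Rational.Unnormalised.Properties as ℚᵘ
  open import Data.Rational.Solver using (module +-*-Solver)

  private
    ι : ℕ → ℚᵘ
    ι n = mkℚᵘ (+ n) 0

    toℚᵘ-ℕtoℚ : ∀ n → toℚᵘ (ℕtoℚ n) ≃ ι n
    toℚᵘ-ℕtoℚ n = toℚᵘ-fromℚᵘ (ι n)

  ℕtoℚ-homo-+ : ∀ m n → ℕtoℚ (m ℕ.+ n) ≡ ℕtoℚ m + ℕtoℚ n
  ℕtoℚ-homo-+ m n = toℚᵘ-injective (begin
    toℚᵘ (ℕtoℚ (m ℕ.+ n))            ≈⟨ toℚᵘ-ℕtoℚ (m ℕ.+ n) ⟩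
    ι (m ℕ.+ n)                       ≈⟨ ℚᵘ.*≡* (cong (ℤ._* + 1) (cong₂ ℤ._+_ (sym (ℤ.*-identityʳ (+ m))) (sym (ℤ.*-identityʳ (+ n))))) ⟩
    ι m ℚᵘ.+ ι n                      ≈⟨ ℚᵘ.+-cong (ℚᵘ.≃-sym (toℚᵘ-ℕtoℚ m)) (ℚᵘ.≃-sym (toℚᵘ-ℕtoℚ n)) ⟩
    toℚᵘ (ℕtoℚ m) ℚᵘ.+ toℚᵘ (ℕtoℚ n) ≈⟨ ℚᵘ.≃-sym (toℚᵘ-homo-+ (ℕtoℚ m) (ℕtoℚ n)) ⟩
    toℚᵘ (ℕtoℚ m + ℕtoℚ n)            ∎)
    where open ℚᵘ.≃-Reasoning

  ℕtoℚ-homo-* : ∀ m n → ℕtoℚ (m ℕ.* n) ≡ ℕtoℚ m * ℕtoℚ n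
  ℕtoℚ-homo-* m n = toℚᵘ-injective (begin
    toℚᵘ (ℕtoℚ (m ℕ.* n))            ≈⟨ toℚᵘ-ℕtoℚ (m ℕ.* n) ⟩
    ι (m ℕ.* n)                       ≈⟨ ℚᵘ.*≡* (cong (ℤ._* + 1) (ℤ.pos-* m n)) ⟩
    ι m ℚᵘ.* ι n                      ≈⟨ ℚᵘ.*-cong (ℚᵘ.≃-sym (toℚᵘ-ℕtoℚ m)) (ℚᵘ.≃-sym (toℚᵘ-ℕtoℚ n)) ⟩
    toℚᵘ (ℕtoℚ m) ℚᵘ.* toℚᵘ (ℕtoℚ n) ≈⟨ ℚᵘ.≃-sym (toℚᵘ-homo-* (ℕtoℚ m) (ℕtoℚ n)) ⟩
    toℚᵘ (ℕtoℚ m * ℕtoℚ n)            ∎)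
    where open ℚᵘ.≃-Reasoning

  ℕtoℚ-mono-≤ : ∀ {m n} → m ℕ.≤ n → ℕtoℚ m ≤ ℕtoℚ n
  ℕtoℚ-mono-≤ {m} {n} m≤n = toℚᵘ-cancel-≤ (begin
    toℚᵘ (ℕtoℚ m) ≃⟨ toℚᵘ-ℕtoℚ m ⟩
    ι m           ≤⟨ ℚᵘ.*≤* (ℤ.*-monoʳ-≤-nonNeg (+ 1) (ℤ.+≤+ m≤n)) ⟩
    ι n           ≃⟨ ℚᵘ.≃-sym (toℚᵘ-ℕtoℚ n) ⟩
    toℚᵘ (ℕtoℚ n) ∎)
    where open ℚᵘ.≤-Reasoning

  ℕtoℚ-nonNeg : ∀ n → NonNegative (ℕtoℚ n)
  ℕtoℚ-nonNeg n = nonNegative (ℕtoℚ-mono-≤ {0} {n} ℕ.z≤n)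

  archimedean : ∀ μ → 0ℚ < μ → ∃ λ M → 1ℚ ≤ μ * ℕtoℚ M
  archimedean μ@(mkℚ +[1+ k ] d _) _ = suc d , toℚᵘ-cancel-≤ (begin
    ℚᵘ.1ℚᵘ                                          ≤⟨ ℚᵘ.*≤* (ℤ.+≤+ (ℕ.s≤s d≤)) ⟩
    mkℚᵘ +[1+ k ] d ℚᵘ.* ι (suc d)                   ≃⟨ ℚᵘ.*-congˡ {mkℚᵘ +[1+ k ] d} (ℚᵘ.≃-sym (toℚᵘ-ℕtoℚ (suc d))) ⟩
    toℚᵘ μ ℚᵘ.* toℚᵘ (ℕtoℚ (suc d))                 ≃⟨ ℚᵘ.≃-sym (toℚᵘ-homo-* μ (ℕtoℚ (suc d))) ⟩
    toℚᵘ (μ * ℕtoℚ (suc d))                          ∎)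
    where
    open ℚᵘ.≤-Reasoning
    d≤ : d ℕ.* 1 ℕ.+ 0 ℕ.≤ (d ℕ.+ k ℕ.* suc d) ℕ.* 1
    d≤ rewrite ℕ.+-identityʳ (d ℕ.* 1) | ℕ.*-identityʳ d | ℕ.*-identityʳ (d ℕ.+ k ℕ.* suc d) = ℕ.m≤m+n d _
  archimedean μ@(mkℚ (+ 0) _ _) 0<μ = contradiction (ℤ.positive⁻¹ _ {{positive 0<μ}}) (ℤ.<-irrefl refl)
  archimedean μ@(mkℚ -[1+ _ ] _ _) 0<μ = contradiction (ℤ.positive⁻¹ _ {{positive 0<μ}}) (ℤ.<-asym (ℤ.negative⁻¹ _))

  1/suc : ℕ → ℚ
  1/suc m = mkℚ (+ 1) m (Coprimality.1-coprimeTo _)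

  1/suc-*-suc : ∀ m → 1/suc m * ℕtoℚ (suc m) ≡ 1ℚ
  1/suc-*-suc m = toℚᵘ-injective (begin
    toℚᵘ (1/suc m * ℕtoℚ (suc m))            ≈⟨ toℚᵘ-homo-* (1/suc m) (ℕtoℚ (suc m)) ⟩
    mkℚᵘ (+ 1) m ℚᵘ.* toℚᵘ (ℕtoℚ (suc m))    ≈⟨ ℚᵘ.*-congˡ {mkℚᵘ (+ 1) m} (toℚᵘ-ℕtoℚ (suc m)) ⟩
    mkℚᵘ (+ 1) m ℚᵘ.* ι (suc m)              ≈⟨ ℚᵘ.*≡* (trans (ℤ.*-identityʳ _) (cong (λ x → + 1 ℤ.* + x) (sym (ℕ.*-identityʳ (suc m))))) ⟩
    ℚᵘ.1ℚᵘ                                    ∎)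
    where open ℚᵘ.≃-Reasoning

  1/suc-pos : ∀ m → 0ℚ < 1/suc m
  1/suc-pos m = *<* (ℤ.+<+ (ℕ.s≤s ℕ.z≤n))

  1/suc-<1 : ∀ m → 1/suc (suc m) < 1ℚ
  1/suc-<1 m = *<* (ℤ.+<+ (ℕ.s≤s (ℕ.s≤s ℕ.z≤n)))

  1/suc-*-≤ : ∀ m c N → N ℕ.≤ suc m ℕ.* c → 1/suc m * ℕtoℚ N ≤ ℕtoℚ c
  1/suc-*-≤ m c N N≤ = begin
    1/suc m * ℕtoℚ N                      ≤⟨ *-monoˡ-≤-nonNeg (1/suc m) {{nonNegative (<⇒≤ (1/suc-pos m))}} (ℕtoℚ-mono-≤ N≤) ⟩
    1/suc m * ℕtoℚ (suc m ℕ.* c)          ≡⟨ cong (1/suc m *_) (ℕtoℚ-homo-* (suc m) c) ⟩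
    1/suc m * (ℕtoℚ (suc m) * ℕtoℚ c)     ≡⟨ sym (*-assoc (1/suc m) (ℕtoℚ (suc m)) (ℕtoℚ c)) ⟩
    1/suc m * ℕtoℚ (suc m) * ℕtoℚ c       ≡⟨ cong (_* ℕtoℚ c) (1/suc-*-suc m) ⟩
    1ℚ * ℕtoℚ c                           ≡⟨ *-identityˡ _ ⟩
    ℕtoℚ c                                ∎
    where open ≤-Reasoning

  half-pos : ∀ {p} → 0ℚ < p → 0ℚ < p * ½
  half-pos 0<p = *-monoˡ-<-pos ½ 0<p

  half-≤ : ∀ {p} → 0ℚ ≤ p → p * ½ ≤ p
  half-≤ {p} 0≤p = begin
    p * ½   ≤⟨ *-monoˡ-≤-nonNeg p {{nonNegative 0≤p}} {½} {1ℚ} (*≤* (ℤ.+≤+ (ℕ.s≤s ℕ.z≤n))) ⟩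
    p * 1ℚ  ≡⟨ *-identityʳ p ⟩
    p       ∎
    where open ≤-Reasoning

  half-<1 : ∀ {p} → p ≤ 1ℚ → p * ½ < 1ℚ
  half-<1 {p} p≤1 = begin-strict
    p * ½   ≤⟨ *-monoʳ-≤-nonNeg ½ p≤1 ⟩
    1ℚ * ½  ≡⟨ *-identityˡ ½ ⟩
    ½       <⟨ *<* (ℤ.+<+ (ℕ.s≤s (ℕ.s≤s ℕ.z≤n))) ⟩
    1ℚ      ∎
    where open ≤-Reasoning

  -- The arithmetic core of the density of a padded graph: X = Y + T counts the triples of
  -- X₁ × X₂ × X₃ (Y inside the old vertices, T the rest), and D bounds the degenerate ones.
  padding-density-bound : ∀ (p p′ μ μ′ : ℚ) (X Y T C C₀ D n³ N³ : ℕ) →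
    0ℚ ≤ p′ → p′ ≤ p → p′ ≤ 1ℚ →
    X ≡ Y ℕ.+ T → C₀ ℕ.+ T ℕ.≤ C ℕ.+ D →
    p * ℕtoℚ Y - μ * ℕtoℚ n³ ≤ ℕtoℚ C₀ →
    μ * ℕtoℚ n³ + ℕtoℚ D ≤ μ′ * ℕtoℚ N³ →
    p′ * ℕtoℚ X - μ′ * ℕtoℚ N³ ≤ ℕtoℚ C
  padding-density-bound p p′ μ μ′ X Y T C C₀ D n³ N³ 0≤p′ p′≤p p′≤1 X≡Y+T C₀+T≤C+D dense budget = begin
    p′ * x X - e′
      ≡⟨ cong (λ z → p′ * z - e′) (trans (cong x X≡Y+T) (ℕtoℚ-homo-+ Y T)) ⟩
    p′ * (x Y + x T) - e′
      ≡⟨ solve 4 (λ a y t e → a :* (y :+ t) :- e := (a :* y :+ a :* t) :- e) refl p′ (x Y) (x T) e′ ⟩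
    (p′ * x Y + p′ * x T) - e′
      ≤⟨ +-monoˡ-≤ (- e′) (+-mono-≤ (*-monoʳ-≤-nonNeg (x Y) {{ℕtoℚ-nonNeg Y}} p′≤p)
                                     (≤-trans (*-monoʳ-≤-nonNeg (x T) {{ℕtoℚ-nonNeg T}} p′≤1) (≤-reflexive (*-identityˡ (x T))))) ⟩
    (p * x Y + x T) - e′
      ≡⟨ solve 4 (λ y t e f → (y :+ t) :- e := ((y :- f) :+ t) :+ (f :- e)) refl (p * x Y) (x T) e′ e ⟩
    ((p * x Y - e) + x T) + (e - e′)
      ≤⟨ +-monoˡ-≤ (e - e′) (+-monoˡ-≤ (x T) dense) ⟩
    (x C₀ + x T) + (e - e′)
      ≡⟨ cong (_+ (e - e′)) (sym (ℕtoℚ-homo-+ C₀ T)) ⟩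
    x (C₀ ℕ.+ T) + (e - e′)
      ≤⟨ +-monoˡ-≤ (e - e′) (ℕtoℚ-mono-≤ C₀+T≤C+D) ⟩
    x (C ℕ.+ D) + (e - e′)
      ≡⟨ cong (_+ (e - e′)) (ℕtoℚ-homo-+ C D) ⟩
    (x C + x D) + (e - e′)
      ≡⟨ solve 4 (λ c d f e → (c :+ d) :+ (f :- e) := c :+ ((f :+ d) :- e)) refl (x C) (x D) e e′ ⟩
    x C + ((e + x D) - e′)
      ≤⟨ +-monoʳ-≤ (x C) (+-monoˡ-≤ (- e′) budget) ⟩
    x C + (e′ - e′)
      ≡⟨ solve 2 (λ c e → c :+ (e :- e) := c) refl (x C) e′ ⟩
    x C ∎
    where
    open ≤-Reasoning
    open +-*-Solver
    x = ℕtoℚ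
    e = μ * x n³
    e′ = μ′ * x N³

  -- Half of μ′ N³ pays for the old error term, the other half for the 3N² degenerate triples.
  cube-budget : ∀ (μ′ : ℚ) (n N M : ℕ) → 0ℚ ≤ μ′ → n ℕ.≤ N → 1ℚ ≤ μ′ * ℕtoℚ M → 6 ℕ.* M ℕ.≤ N →
    μ′ * ½ * ℕtoℚ (n ℕ.^ 3) + ℕtoℚ (3 ℕ.* (N ℕ.* N)) ≤ μ′ * ℕtoℚ (N ℕ.^ 3)
  cube-budget μ′ n N M 0≤μ′ n≤N 1≤μ′M 6M≤N = begin
    h * x (n ℕ.^ 3) + x (3 ℕ.* N²)
      ≤⟨ +-mono-≤ (*-monoˡ-≤-nonNeg h {{h-nonNeg}} (ℕtoℚ-mono-≤ (ℕ.^-monoˡ-≤ 3 n≤N))) degenerate≤ ⟩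
    h * x (N ℕ.^ 3) + h * x (N ℕ.^ 3)
      ≡⟨ solve 2 (λ m b → m :* con ½ :* b :+ m :* con ½ :* b := m :* b) refl μ′ (x (N ℕ.^ 3)) ⟩
    μ′ * x (N ℕ.^ 3) ∎
    where
    open ≤-Reasoning
    open +-*-Solver
    x = ℕtoℚ
    h = μ′ * ½
    N² = N ℕ.* N
    h-nonNeg : NonNegative h
    h-nonNeg = nonNegative (≤-trans (≤-reflexive (sym (*-zeroˡ ½))) (*-monoʳ-≤-nonNeg ½ 0≤μ′))
    6MN²≤N³ : 6 ℕ.* M ℕ.* N² ℕ.≤ N ℕ.^ 3
    6MN²≤N³ = ℕ.≤-trans (ℕ.*-monoˡ-≤ N² 6M≤N) (ℕ.≤-reflexive (cong (λ z → N ℕ.* (N ℕ.* z)) (sym (ℕ.*-identityʳ N))))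
    degenerate≤ : x (3 ℕ.* N²) ≤ h * x (N ℕ.^ 3)
    degenerate≤ = begin
      x (3 ℕ.* N²)                 ≡⟨ sym (*-identityˡ _) ⟩
      1ℚ * x (3 ℕ.* N²)            ≤⟨ *-monoʳ-≤-nonNeg (x (3 ℕ.* N²)) {{ℕtoℚ-nonNeg (3 ℕ.* N²)}} 1≤μ′M ⟩
      μ′ * x M * x (3 ℕ.* N²)      ≡⟨ cong (μ′ * x M *_) (ℕtoℚ-homo-* 3 N²) ⟩
      μ′ * x M * (x 3 * x N²)      ≡⟨ solve 3 (λ m a d → (m :* a) :* (con (x 3) :* d) := (m :* con ½) :* ((con (x 6) :* a) :* d)) refl μ′ (x M) (x N²) ⟩
      h * (x 6 * x M * x N²)       ≡⟨ cong (h *_) (trans (cong (_* x N²) (sym (ℕtoℚ-homo-* 6 M))) (sym (ℕtoℚ-homo-* (6 ℕ.* M) N²))) ⟩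
      h * x (6 ℕ.* M ℕ.* N²)       ≤⟨ *-monoˡ-≤-nonNeg h {{h-nonNeg}} (ℕtoℚ-mono-≤ 6MN²≤N³) ⟩
      h * x (N ℕ.^ 3)              ∎

  *-ℕtoℚ³ : ∀ q a b c → q * ℕtoℚ a * ℕtoℚ b * ℕtoℚ c ≡ q * ℕtoℚ (a ℕ.* b ℕ.* c)
  *-ℕtoℚ³ q a b c = begin
    q * ℕtoℚ a * ℕtoℚ b * ℕtoℚ c     ≡⟨ trans (cong (_* ℕtoℚ c) (*-assoc q (ℕtoℚ a) (ℕtoℚ b))) (*-assoc q _ (ℕtoℚ c)) ⟩
    q * (ℕtoℚ a * ℕtoℚ b * ℕtoℚ c)   ≡⟨ cong (q *_) (trans (cong (_* ℕtoℚ c) (sym (ℕtoℚ-homo-* a b))) (sym (ℕtoℚ-homo-* (a ℕ.* b) c))) ⟩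
    q * ℕtoℚ (a ℕ.* b ℕ.* c)          ∎
    where open ≡-Reasoning

open RationalArithmetic
open import Data.Nat using (_+_; _*_; _^_; _≤_; _<_; _∸_)
open import Data.Nat.Divisibility using (_∣_; divides)
open import Data.Nat.DivMod using (_/_; _%_; m≡m%n+[m/n]*n; m%n<n; m*n/n≡m; /-monoˡ-≤)
open import Data.Nat.Solver using (module +-*-Solver)

𝟙 : Bool → ℕ
𝟙 b = if b then 1 else 0

ΣFin-cong : ∀ n {f g : Fin n → ℕ} → (∀ i → f i ≡ g i) → ΣFin n f ≡ ΣFin n g
ΣFin-cong zero    f≡g = refl
ΣFin-cong (suc n) f≡g = cong₂ _+_ (f≡g zero) (ΣFin-cong n (λ i → f≡g (suc i)))

ΣFin-mono-≤ : ∀ n {f g : Fin n → ℕ} → (∀ i → f i ≤ g i) → ΣFin n f ≤ ΣFin n g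
ΣFin-mono-≤ zero    f≤g = ℕ.z≤n
ΣFin-mono-≤ (suc n) f≤g = ℕ.+-mono-≤ (f≤g zero) (ΣFin-mono-≤ n (λ i → f≤g (suc i)))

ΣFin-+ : ∀ n (f g : Fin n → ℕ) → ΣFin n (λ i → f i + g i) ≡ ΣFin n f + ΣFin n g
ΣFin-+ zero    f g = refl
ΣFin-+ (suc n) f g = trans (cong (f zero + g zero +_) (ΣFin-+ n (λ i → f (suc i)) (λ i → g (suc i))))
                           (interchange (f zero) (g zero) _ _)

ΣFin-*ʳ : ∀ n (f : Fin n → ℕ) c → ΣFin n f * c ≡ ΣFin n (λ i → f i * c)
ΣFin-*ʳ zero    f c = refl
ΣFin-*ʳ (suc n) f c = trans (ℕ.*-distribʳ-+ c (f zero) _) (cong (f zero * c +_) (ΣFin-*ʳ n (λ i → f (suc i)) c))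

ΣFin-*ˡ : ∀ n (f : Fin n → ℕ) c → c * ΣFin n f ≡ ΣFin n (λ i → c * f i)
ΣFin-*ˡ n f c = trans (ℕ.*-comm c _) (trans (ΣFin-*ʳ n f c) (ΣFin-cong n (λ i → ℕ.*-comm (f i) c)))

ΣFin-const : ∀ n c → ΣFin n (λ _ → c) ≡ n * c
ΣFin-const zero    c = refl
ΣFin-const (suc n) c = cong (c +_) (ΣFin-const n c)

ΣFin-↑ : ∀ n a (f : Fin (n + a) → ℕ) → ΣFin (n + a) f ≡ ΣFin n (λ i → f (i ↑ˡ a)) + ΣFin a (λ j → f (n ↑ʳ j))
ΣFin-↑ zero    a f = refl
ΣFin-↑ (suc n) a f = trans (cong (f zero +_) (ΣFin-↑ n a (λ i → f (suc i)))) (sym (ℕ.+-assoc (f zero) _ _))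

∣∣≡ΣFin : ∀ n (X : Subset n) → ∣ X ∣ ≡ ΣFin n (λ i → 𝟙 (lookup X i))
∣∣≡ΣFin zero    []          = refl
∣∣≡ΣFin (suc n) (true ∷ X)  = cong suc (∣∣≡ΣFin n X)
∣∣≡ΣFin (suc n) (false ∷ X) = ∣∣≡ΣFin n X

ΣFin-≟-≤1 : ∀ n (u : Fin n) → ΣFin n (λ w → 𝟙 (does (u ≟ w))) ≤ 1
ΣFin-≟-≤1 (suc n) zero    = ℕ.≤-reflexive (cong suc (trans (ΣFin-const n 0) (ℕ.*-zeroʳ n)))
ΣFin-≟-≤1 (suc n) (suc u) = ΣFin-≟-≤1 n u

Σ³ : ∀ m → (Fin m → Fin m → Fin m → ℕ) → ℕ
Σ³ m f = ΣFin m λ x → ΣFin m λ y → ΣFin m λ z → f x y z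

Σ³-cong : ∀ m {f g : Fin m → Fin m → Fin m → ℕ} → (∀ x y z → f x y z ≡ g x y z) → Σ³ m f ≡ Σ³ m g
Σ³-cong m f≡g = ΣFin-cong m λ x → ΣFin-cong m λ y → ΣFin-cong m λ z → f≡g x y z

Σ³-mono-≤ : ∀ m {f g : Fin m → Fin m → Fin m → ℕ} → (∀ x y z → f x y z ≤ g x y z) → Σ³ m f ≤ Σ³ m g
Σ³-mono-≤ m f≤g = ΣFin-mono-≤ m λ x → ΣFin-mono-≤ m λ y → ΣFin-mono-≤ m λ z → f≤g x y z

Σ³-+ : ∀ m (f g : Fin m → Fin m → Fin m → ℕ) → Σ³ m (λ x y z → f x y z + g x y z) ≡ Σ³ m f + Σ³ m g
Σ³-+ m f g = trans (ΣFin-cong m λ x → trans (ΣFin-cong m λ y → ΣFin-+ m (f x y) (g x y)) (ΣFin-+ m _ _)) (ΣFin-+ m _ _)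

ΣFin-*-ΣFin-*-ΣFin : ∀ m (f g h : Fin m → ℕ) → ΣFin m f * ΣFin m g * ΣFin m h ≡ Σ³ m (λ x y z → f x * g y * h z)
ΣFin-*-ΣFin-*-ΣFin m f g h = begin
  ΣFin m f * ΣFin m g * ΣFin m h
    ≡⟨ cong (_* ΣFin m h) (trans (ΣFin-*ʳ m f (ΣFin m g)) (ΣFin-cong m λ x → ΣFin-*ˡ m g (f x))) ⟩
  ΣFin m (λ x → ΣFin m λ y → f x * g y) * ΣFin m h
    ≡⟨ ΣFin-*ʳ m _ (ΣFin m h) ⟩
  ΣFin m (λ x → (ΣFin m λ y → f x * g y) * ΣFin m h)
    ≡⟨ ΣFin-cong m (λ x → trans (ΣFin-*ʳ m _ (ΣFin m h)) (ΣFin-cong m λ y → ΣFin-*ˡ m h (f x * g y))) ⟩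
  Σ³ m (λ x y z → f x * g y * h z) ∎
  where open ≡-Reasoning

∣∣³≡Σ³ : ∀ m (X₁ X₂ X₃ : Subset m) →
  ∣ X₁ ∣ * ∣ X₂ ∣ * ∣ X₃ ∣ ≡ Σ³ m (λ x y z → 𝟙 (lookup X₁ x) * 𝟙 (lookup X₂ y) * 𝟙 (lookup X₃ z))
∣∣³≡Σ³ m X₁ X₂ X₃ = trans (cong₂ _*_ (cong₂ _*_ (∣∣≡ΣFin m X₁) (∣∣≡ΣFin m X₂)) (∣∣≡ΣFin m X₃)) (ΣFin-*-ΣFin-*-ΣFin m _ _ _)

𝟙-∧ : ∀ a b → 𝟙 (a ∧ b) ≡ 𝟙 a * 𝟙 b
𝟙-∧ true  b = sym (ℕ.+-identityʳ (𝟙 b))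
𝟙-∧ false b = refl

𝟙-not-+ : ∀ b → 𝟙 (not b) + 𝟙 b ≡ 1
𝟙-not-+ true  = refl
𝟙-not-+ false = refl

𝟙-∨-≤ : ∀ a b → 𝟙 (a ∨ b) ≤ 𝟙 a + 𝟙 b
𝟙-∨-≤ true  b = ℕ.s≤s ℕ.z≤n
𝟙-∨-≤ false b = ℕ.≤-refl

𝟙-split : ∀ b c → 𝟙 b * c + 𝟙 (not b) * c ≡ c
𝟙-split true  c = trans (ℕ.+-identityʳ (1 * c)) (ℕ.*-identityˡ c)
𝟙-split false c = ℕ.*-identityˡ c

does-≟-sym : ∀ {m} (x y : Fin m) → does (x ≟ y) ≡ does (y ≟ x)
does-≟-sym x y with x ≟ y
... | yes x≡y = sym (dec-true (y ≟ x) (sym x≡y))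
... | no  x≢y = sym (dec-false (y ≟ x) (λ y≡x → x≢y (sym y≡x)))

does-≟-false : ∀ {m} {x y : Fin m} → does (x ≟ y) ≡ false → x ≢ y
does-≟-false {x = x} {y} ≟-false x≡y with () ← trans (sym ≟-false) (dec-true (x ≟ y) x≡y)

coincident : ∀ {m} → Fin m → Fin m → Fin m → Bool
coincident x y z = does (x ≟ y) ∨ does (y ≟ z) ∨ does (x ≟ z)

coincident-sym₁₂ : ∀ {m} (x y z : Fin m) → coincident x y z ≡ coincident y x z
coincident-sym₁₂ x y z = cong₂ _∨_ (does-≟-sym x y) (∨-comm (does (y ≟ z)) (does (x ≟ z)))

coincident-sym₂₃ : ∀ {m} (x y z : Fin m) → coincident x y z ≡ coincident x z y
coincident-sym₂₃ x y z = begin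
  xy ∨ (does (y ≟ z) ∨ xz)   ≡⟨ ∨-comm xy _ ⟩
  (does (y ≟ z) ∨ xz) ∨ xy   ≡⟨ cong (_∨ xy) (∨-comm (does (y ≟ z)) xz) ⟩
  (xz ∨ does (y ≟ z)) ∨ xy   ≡⟨ ∨-assoc xz _ xy ⟩
  xz ∨ (does (y ≟ z) ∨ xy)   ≡⟨ cong (λ b → xz ∨ (b ∨ xy)) (does-≟-sym y z) ⟩
  xz ∨ (does (z ≟ y) ∨ xy)   ∎
  where
  open ≡-Reasoning
  xy = does (x ≟ y)
  xz = does (x ≟ z)

not-∨-∨ : ∀ a b c → not (a ∨ b ∨ c) ≡ true → (a ≡ false) × (b ≡ false) × (c ≡ false)
not-∨-∨ false false false _ = refl , refl , refl
not-∨-∨ true  _     _     ()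
not-∨-∨ false true  _     ()
not-∨-∨ false false true  ()

not-coincident⇒distinct : ∀ {m} (x y z : Fin m) → not (coincident x y z) ≡ true → (x ≢ y) × (y ≢ z) × (x ≢ z)
not-coincident⇒distinct x y z h with not-∨-∨ (does (x ≟ y)) (does (y ≟ z)) (does (x ≟ z)) h
... | xy , yz , xz = does-≟-false xy , does-≟-false yz , does-≟-false xz

Σ³-coincident-≤ : ∀ m → Σ³ m (λ x y z → 𝟙 (coincident x y z)) ≤ 3 * (m * m)
Σ³-coincident-≤ m = begin
  Σ³ m (λ x y z → 𝟙 (coincident x y z))
    ≤⟨ Σ³-mono-≤ m (λ x y z → 𝟙-∨-∨-≤ (does (x ≟ y)) (does (y ≟ z)) (does (x ≟ z))) ⟩
  Σ³ m (λ x y z → 𝟙 (does (x ≟ y)) + 𝟙 (does (y ≟ z)) + 𝟙 (does (x ≟ z)))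
    ≤⟨ ΣFin-mono-≤ m (λ x → ΣFin-mono-≤ m λ y → inner x y) ⟩
  ΣFin m (λ x → ΣFin m λ y → m * 𝟙 (does (x ≟ y)) + 2)
    ≡⟨ ΣFin-cong m (λ x → trans (ΣFin-+ m _ (λ _ → 2)) (cong₂ _+_ (sym (ΣFin-*ˡ m _ m)) (ΣFin-const m 2))) ⟩
  ΣFin m (λ x → m * ΣFin m (λ y → 𝟙 (does (x ≟ y))) + m * 2)
    ≤⟨ ΣFin-mono-≤ m (λ x → ℕ.+-monoˡ-≤ (m * 2) (ℕ.*-monoʳ-≤ m (ΣFin-≟-≤1 m x))) ⟩
  ΣFin m (λ _ → m * 1 + m * 2)
    ≡⟨ ΣFin-const m _ ⟩
  m * (m * 1 + m * 2)
    ≡⟨ solve 1 (λ m → m :* (m :* con 1 :+ m :* con 2) := con 3 :* (m :* m)) refl m ⟩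
  3 * (m * m) ∎
  where
  open ℕ.≤-Reasoning
  open +-*-Solver
  𝟙-∨-∨-≤ : ∀ a b c → 𝟙 (a ∨ b ∨ c) ≤ 𝟙 a + 𝟙 b + 𝟙 c
  𝟙-∨-∨-≤ a b c = ℕ.≤-trans (𝟙-∨-≤ a (b ∨ c)) (ℕ.≤-trans (ℕ.+-monoʳ-≤ (𝟙 a) (𝟙-∨-≤ b c)) (ℕ.≤-reflexive (sym (ℕ.+-assoc (𝟙 a) _ _))))
  inner : ∀ x y → ΣFin m (λ z → 𝟙 (does (x ≟ y)) + 𝟙 (does (y ≟ z)) + 𝟙 (does (x ≟ z))) ≤ m * 𝟙 (does (x ≟ y)) + 2
  inner x y = begin
    ΣFin m (λ z → 𝟙 (does (x ≟ y)) + 𝟙 (does (y ≟ z)) + 𝟙 (does (x ≟ z)))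
      ≡⟨ trans (ΣFin-+ m _ _) (cong (_+ _) (trans (ΣFin-+ m _ _) (cong (_+ _) (ΣFin-const m _)))) ⟩
    m * 𝟙 (does (x ≟ y)) + ΣFin m (λ z → 𝟙 (does (y ≟ z))) + ΣFin m (λ z → 𝟙 (does (x ≟ z)))
      ≤⟨ ℕ.+-mono-≤ (ℕ.+-monoʳ-≤ (m * 𝟙 (does (x ≟ y))) (ΣFin-≟-≤1 m y)) (ΣFin-≟-≤1 m x) ⟩
    m * 𝟙 (does (x ≟ y)) + 1 + 1
      ≡⟨ ℕ.+-assoc _ 1 1 ⟩
    m * 𝟙 (does (x ≟ y)) + 2 ∎

boxedEdge : Bool → Bool → Bool → Bool → Bool
boxedEdge s₁ s₂ s₃ e = if s₁ then (if s₂ then (if s₃ then e else false) else false) else false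

-- Pointwise form of C₀ + T ≤ C + D: on an all-old triple o the padded graph agrees with the
-- old one, and otherwise every triple of the box is an edge unless it is degenerate (d).
boxedEdge-split-≤ : ∀ o s₁ s₂ s₃ e d → (o ≡ false → e ≡ not d) →
  𝟙 o * 𝟙 (boxedEdge s₁ s₂ s₃ e) + 𝟙 (not o) * (𝟙 s₁ * 𝟙 s₂ * 𝟙 s₃) ≤ 𝟙 (boxedEdge s₁ s₂ s₃ e) + 𝟙 d
boxedEdge-split-≤ true  s₁    s₂    s₃    e d _ =
  ℕ.≤-trans (ℕ.≤-reflexive (trans (ℕ.+-identityʳ _) (ℕ.*-identityˡ _))) (ℕ.m≤m+n _ (𝟙 d))
boxedEdge-split-≤ false true  true  true  e d e≡ rewrite e≡ refl = ℕ.≤-reflexive (sym (𝟙-not-+ d))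
boxedEdge-split-≤ false true  true  false e d _ = ℕ.z≤n
boxedEdge-split-≤ false true  false s₃    e d _ = ℕ.z≤n
boxedEdge-split-≤ false false s₂    s₃    e d _ = ℕ.z≤n

factor-covers : ∀ {k n} {F : ThreeGraph k} {H : ThreeGraph n} (f : HasFactor F H) → n ≤ proj₁ f * k
factor-covers {k} (m , φ , _ , _ , cover) = injective⇒≤ position-injective
  where
  position : Fin _ → Fin (m * k)
  position v = Fin.combine (proj₁ (cover v)) (proj₁ (proj₂ (cover v)))
  position-injective : ∀ {v w} → position v ≡ position w → v ≡ w
  position-injective {v} {w} eq with cover v | cover w
  ... | i , j , φij≡v | i′ , j′ , φi′j′≡w with combine-injective i j i′ j′ eq
  ... | refl , refl = trans (sym φij≡v) φi′j′≡w

contains-order≤1 : ∀ {k n} (F : ThreeGraph k) (H : ThreeGraph (suc n)) → k ≤ 1 → Contains F H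
contains-order≤1 {zero}  F H _ = (λ ()) , (λ {x} → ⊥-elim (¬Fin0 x)) , (λ ())
contains-order≤1 {suc zero} F H _ =
  (λ _ → zero) , (λ { {zero} {zero} _ → refl }) , (λ { zero zero zero e → ⊥-elim (proj₁ (distinct F zero zero zero e) refl) })
contains-order≤1 {suc (suc _)} F H (ℕ.s≤s ())

module Padded {n : ℕ} (H₀ : ThreeGraph n) (a : ℕ) where

  isOld : Fin (n + a) → Bool
  isOld x = is-just (isInj₁ (splitAt n x))

  private
    Part = Fin n ⊎ Fin a

    isLeft : Part → Bool
    isLeft s = is-just (isInj₁ s)

  padEdge : Part → Part → Part → Bool → Bool
  padEdge (inj₁ i) (inj₁ j) (inj₁ l) _ = edge H₀ i j l
  padEdge (inj₁ _) (inj₁ _) (inj₂ _) d = d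
  padEdge (inj₁ _) (inj₂ _) _        d = d
  padEdge (inj₂ _) _        _        d = d

  padEdge-sym₁₂ : ∀ s t u {d d′} → d ≡ d′ → padEdge s t u d ≡ padEdge t s u d′
  padEdge-sym₁₂ (inj₁ i) (inj₁ j) (inj₁ l) _ = sym₁₂ H₀ i j l
  padEdge-sym₁₂ (inj₁ _) (inj₁ _) (inj₂ _) d≡d′ = d≡d′
  padEdge-sym₁₂ (inj₁ _) (inj₂ _) _        d≡d′ = d≡d′
  padEdge-sym₁₂ (inj₂ _) (inj₁ _) _        d≡d′ = d≡d′
  padEdge-sym₁₂ (inj₂ _) (inj₂ _) _        d≡d′ = d≡d′

  padEdge-sym₂₃ : ∀ s t u {d d′} → d ≡ d′ → padEdge s t u d ≡ padEdge s u t d′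
  padEdge-sym₂₃ (inj₁ i) (inj₁ j) (inj₁ l) _ = sym₂₃ H₀ i j l
  padEdge-sym₂₃ (inj₁ _) (inj₁ _) (inj₂ _) d≡d′ = d≡d′
  padEdge-sym₂₃ (inj₁ _) (inj₂ _) (inj₁ _) d≡d′ = d≡d′
  padEdge-sym₂₃ (inj₁ _) (inj₂ _) (inj₂ _) d≡d′ = d≡d′
  padEdge-sym₂₃ (inj₂ _) _        _        d≡d′ = d≡d′

  padEdge-distinct : ∀ s t u d → padEdge s t u d ≡ true → (d ≡ true) ⊎ ((s ≢ t) × (t ≢ u) × (s ≢ u))
  padEdge-distinct (inj₁ i) (inj₁ j) (inj₁ l) _ e with distinct H₀ i j l e
  ... | i≢j , j≢l , i≢l = inj₂ ((λ eq → i≢j (inj₁-injective eq)) , (λ eq → j≢l (inj₁-injective eq)) , (λ eq → i≢l (inj₁-injective eq)))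
  padEdge-distinct (inj₁ _) (inj₁ _) (inj₂ _) _ e = inj₁ e
  padEdge-distinct (inj₁ _) (inj₂ _) _        _ e = inj₁ e
  padEdge-distinct (inj₂ _) _        _        _ e = inj₁ e

  padEdge-notAllLeft : ∀ s t u d → isLeft s ∧ isLeft t ∧ isLeft u ≡ false → padEdge s t u d ≡ d
  padEdge-notAllLeft (inj₁ _) (inj₁ _) (inj₁ _) _ ()
  padEdge-notAllLeft (inj₁ _) (inj₁ _) (inj₂ _) _ _ = refl
  padEdge-notAllLeft (inj₁ _) (inj₂ _) _        _ _ = refl
  padEdge-notAllLeft (inj₂ _) _        _        _ _ = refl

  paddedEdge : Fin (n + a) → Fin (n + a) → Fin (n + a) → Bool
  paddedEdge x y z = padEdge (splitAt n x) (splitAt n y) (splitAt n z) (not (coincident x y z))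

  padded : ThreeGraph (n + a)
  padded = record
    { edge     = paddedEdge
    ; sym₁₂    = λ x y z → padEdge-sym₁₂ (splitAt n x) (splitAt n y) (splitAt n z) (cong not (coincident-sym₁₂ x y z))
    ; sym₂₃    = λ x y z → padEdge-sym₂₃ (splitAt n x) (splitAt n y) (splitAt n z) (cong not (coincident-sym₂₃ x y z))
    ; distinct = padded-distinct
    }
    where
    padded-distinct : ∀ x y z → paddedEdge x y z ≡ true → (x ≢ y) × (y ≢ z) × (x ≢ z)
    padded-distinct x y z e with padEdge-distinct (splitAt n x) (splitAt n y) (splitAt n z) _ e
    ... | inj₁ not-coinc = not-coincident⇒distinct x y z not-coinc
    ... | inj₂ (xy , yz , xz) = (λ eq → xy (cong (splitAt n) eq)) , (λ eq → yz (cong (splitAt n) eq)) , (λ eq → xz (cong (splitAt n) eq))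

  isOld-↑ˡ : ∀ i → isOld (i ↑ˡ a) ≡ true
  isOld-↑ˡ i = cong isLeft (splitAt-↑ˡ n i a)

  isOld-↑ʳ : ∀ j → isOld (n ↑ʳ j) ≡ false
  isOld-↑ʳ j = cong isLeft (splitAt-↑ʳ n a j)

  old-index : ∀ x → isOld x ≡ true → ∃ λ i → i ↑ˡ a ≡ x
  old-index x old with splitAt n x in eq
  old-index x old | inj₁ i = i , splitAt⁻¹-↑ˡ eq
  old-index x ()  | inj₂ _

  new-index : ∀ x → isOld x ≡ false → ∃ λ j → n ↑ʳ j ≡ x
  new-index x new with splitAt n x in eq
  new-index x ()  | inj₁ _
  new-index x new | inj₂ j = j , splitAt⁻¹-↑ʳ eq

  edge-↑ˡ : ∀ i j l → edge padded (i ↑ˡ a) (j ↑ˡ a) (l ↑ˡ a) ≡ edge H₀ i j l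
  edge-↑ˡ i j l rewrite splitAt-↑ˡ n i a | splitAt-↑ˡ n j a | splitAt-↑ˡ n l a = refl

  edge-notAllOld : ∀ x y z → isOld x ∧ isOld y ∧ isOld z ≡ false → edge padded x y z ≡ not (coincident x y z)
  edge-notAllOld x y z = padEdge-notAllLeft (splitAt n x) (splitAt n y) (splitAt n z) _

  ΣFin-isOld : ∀ (f : Fin (n + a) → ℕ) → ΣFin (n + a) (λ v → 𝟙 (isOld v) * f v) ≡ ΣFin n (λ i → f (i ↑ˡ a))
  ΣFin-isOld f = begin
    ΣFin (n + a) (λ v → 𝟙 (isOld v) * f v)
      ≡⟨ ΣFin-↑ n a (λ v → 𝟙 (isOld v) * f v) ⟩
    ΣFin n (λ i → 𝟙 (isOld (i ↑ˡ a)) * f (i ↑ˡ a)) + ΣFin a (λ j → 𝟙 (isOld (n ↑ʳ j)) * f (n ↑ʳ j))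
      ≡⟨ cong₂ _+_ (ΣFin-cong n λ i → trans (cong (λ b → 𝟙 b * f (i ↑ˡ a)) (isOld-↑ˡ i)) (ℕ.*-identityˡ _))
                   (trans (ΣFin-cong a λ j → cong (λ b → 𝟙 b * f (n ↑ʳ j)) (isOld-↑ʳ j)) (trans (ΣFin-const a 0) (ℕ.*-zeroʳ a))) ⟩
    ΣFin n (λ i → f (i ↑ˡ a)) + 0
      ≡⟨ ℕ.+-identityʳ _ ⟩
    ΣFin n (λ i → f (i ↑ˡ a)) ∎
    where open ≡-Reasoning

  ΣFin-isNew : ΣFin (n + a) (λ v → 𝟙 (not (isOld v))) ≡ a
  ΣFin-isNew = begin
    ΣFin (n + a) (λ v → 𝟙 (not (isOld v)))
      ≡⟨ ΣFin-↑ n a (λ v → 𝟙 (not (isOld v))) ⟩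
    ΣFin n (λ i → 𝟙 (not (isOld (i ↑ˡ a)))) + ΣFin a (λ j → 𝟙 (not (isOld (n ↑ʳ j))))
      ≡⟨ cong₂ _+_ (trans (ΣFin-cong n λ i → cong (λ b → 𝟙 (not b)) (isOld-↑ˡ i)) (trans (ΣFin-const n 0) (ℕ.*-zeroʳ n)))
                   (trans (ΣFin-cong a λ j → cong (λ b → 𝟙 (not b)) (isOld-↑ʳ j)) (trans (ΣFin-const a 1) (ℕ.*-identityʳ a))) ⟩
    a ∎
    where open ≡-Reasoning

  Σ³-isOld : ∀ (g : Fin (n + a) → Fin (n + a) → Fin (n + a) → ℕ) →
    Σ³ (n + a) (λ x y z → 𝟙 (isOld x ∧ isOld y ∧ isOld z) * g x y z) ≡ Σ³ n (λ i j l → g (i ↑ˡ a) (j ↑ˡ a) (l ↑ˡ a))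
  Σ³-isOld g = begin
    Σ³ (n + a) (λ x y z → 𝟙 (isOld x ∧ isOld y ∧ isOld z) * g x y z)
      ≡⟨ Σ³-cong (n + a) (λ x y z → weight x y z) ⟩
    ΣFin (n + a) (λ x → ΣFin (n + a) λ y → ΣFin (n + a) λ z → 𝟙 (isOld x) * (𝟙 (isOld y) * (𝟙 (isOld z) * g x y z)))
      ≡⟨ ΣFin-cong (n + a) (λ x → ΣFin-cong (n + a) λ y → sym (ΣFin-*ˡ (n + a) _ (𝟙 (isOld x)))) ⟩
    ΣFin (n + a) (λ x → ΣFin (n + a) λ y → 𝟙 (isOld x) * ΣFin (n + a) λ z → 𝟙 (isOld y) * (𝟙 (isOld z) * g x y z))
      ≡⟨ ΣFin-cong (n + a) (λ x → ΣFin-cong (n + a) λ y → cong (𝟙 (isOld x) *_) (sym (ΣFin-*ˡ (n + a) _ (𝟙 (isOld y))))) ⟩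
    ΣFin (n + a) (λ x → ΣFin (n + a) λ y → 𝟙 (isOld x) * (𝟙 (isOld y) * ΣFin (n + a) λ z → 𝟙 (isOld z) * g x y z))
      ≡⟨ ΣFin-cong (n + a) (λ x → ΣFin-cong (n + a) λ y → cong (λ s → 𝟙 (isOld x) * (𝟙 (isOld y) * s)) (ΣFin-isOld (g x y))) ⟩
    ΣFin (n + a) (λ x → ΣFin (n + a) λ y → 𝟙 (isOld x) * (𝟙 (isOld y) * ΣFin n λ l → g x y (l ↑ˡ a)))
      ≡⟨ ΣFin-cong (n + a) (λ x → sym (ΣFin-*ˡ (n + a) _ (𝟙 (isOld x)))) ⟩
    ΣFin (n + a) (λ x → 𝟙 (isOld x) * ΣFin (n + a) λ y → 𝟙 (isOld y) * ΣFin n λ l → g x y (l ↑ˡ a))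
      ≡⟨ ΣFin-cong (n + a) (λ x → cong (𝟙 (isOld x) *_) (ΣFin-isOld (λ y → ΣFin n λ l → g x y (l ↑ˡ a)))) ⟩
    ΣFin (n + a) (λ x → 𝟙 (isOld x) * ΣFin n λ j → ΣFin n λ l → g x (j ↑ˡ a) (l ↑ˡ a))
      ≡⟨ ΣFin-isOld (λ x → ΣFin n λ j → ΣFin n λ l → g x (j ↑ˡ a) (l ↑ˡ a)) ⟩
    Σ³ n (λ i j l → g (i ↑ˡ a) (j ↑ˡ a) (l ↑ˡ a)) ∎
    where
    open ≡-Reasoning
    weight : ∀ x y z → 𝟙 (isOld x ∧ isOld y ∧ isOld z) * g x y z ≡ 𝟙 (isOld x) * (𝟙 (isOld y) * (𝟙 (isOld z) * g x y z))
    weight x y z = begin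
      𝟙 (isOld x ∧ isOld y ∧ isOld z) * g x y z
        ≡⟨ cong (_* g x y z) (trans (𝟙-∧ (isOld x) _) (cong (𝟙 (isOld x) *_) (𝟙-∧ (isOld y) (isOld z)))) ⟩
      𝟙 (isOld x) * (𝟙 (isOld y) * 𝟙 (isOld z)) * g x y z
        ≡⟨ trans (ℕ.*-assoc (𝟙 (isOld x)) _ _) (cong (𝟙 (isOld x) *_) (ℕ.*-assoc (𝟙 (isOld y)) _ _)) ⟩
      𝟙 (isOld x) * (𝟙 (isOld y) * (𝟙 (isOld z) * g x y z)) ∎

  padded-codeg : ∀ u v → u ≢ v → a ≤ codeg padded u v + 2
  padded-codeg u v u≢v = begin
    a
      ≡⟨ sym ΣFin-isNew ⟩
    ΣFin (n + a) (λ w → 𝟙 (not (isOld w)))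
      ≤⟨ ΣFin-mono-≤ (n + a) new-≤ ⟩
    ΣFin (n + a) (λ w → 𝟙 (edge padded u v w) + 𝟙 (does (v ≟ w)) + 𝟙 (does (u ≟ w)))
      ≡⟨ trans (ΣFin-+ (n + a) _ _) (cong (_+ _) (ΣFin-+ (n + a) _ _)) ⟩
    codeg padded u v + ΣFin (n + a) (λ w → 𝟙 (does (v ≟ w))) + ΣFin (n + a) (λ w → 𝟙 (does (u ≟ w)))
      ≤⟨ ℕ.+-mono-≤ (ℕ.+-monoʳ-≤ (codeg padded u v) (ΣFin-≟-≤1 (n + a) v)) (ΣFin-≟-≤1 (n + a) u) ⟩
    codeg padded u v + 1 + 1
      ≡⟨ ℕ.+-assoc _ 1 1 ⟩
    codeg padded u v + 2 ∎
    where
    open ℕ.≤-Reasoning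
    -- A new vertex w forms an edge with u and v unless it coincides with one of them.
    new-≤ : ∀ w → 𝟙 (not (isOld w)) ≤ 𝟙 (edge padded u v w) + 𝟙 (does (v ≟ w)) + 𝟙 (does (u ≟ w))
    new-≤ w with isOld w in w-new
    ... | true  = ℕ.z≤n
    ... | false = begin
      1                                             ≡⟨ sym (𝟙-not-+ c) ⟩
      𝟙 (not c) + 𝟙 c                               ≤⟨ ℕ.+-monoʳ-≤ (𝟙 (not c)) (𝟙-∨-≤ (does (v ≟ w)) (does (u ≟ w))) ⟩
      𝟙 (not c) + (𝟙 (does (v ≟ w)) + 𝟙 (does (u ≟ w))) ≡⟨ sym (ℕ.+-assoc (𝟙 (not c)) _ _) ⟩
      𝟙 (not c) + 𝟙 (does (v ≟ w)) + 𝟙 (does (u ≟ w)) ≡⟨ cong (λ b → 𝟙 b + _ + _) (sym uvw-edge) ⟩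
      𝟙 (edge padded u v w) + 𝟙 (does (v ≟ w)) + 𝟙 (does (u ≟ w)) ∎
      where
      c = does (v ≟ w) ∨ does (u ≟ w)
      uvw-edge : edge padded u v w ≡ not c
      uvw-edge = trans (edge-notAllOld u v w notAllOld) (cong (λ b → not (b ∨ c)) (dec-false (u ≟ v) u≢v))
        where
        notAllOld = trans (cong (λ b → isOld u ∧ isOld v ∧ b) w-new) (trans (cong (isOld u ∧_) (∧-zeroʳ _)) (∧-zeroʳ _))

  copy-meets-new : ∀ {k} {F : ThreeGraph k} {φ : Fin k → Fin (n + a)} →
    FFree F H₀ → IsEmbedding F padded φ → ∃ λ j → isOld (φ j) ≡ false
  copy-meets-new {k} {F} {φ} free (φ-injective , φ-edge) =
    map₂ ¬-not (¬∀⟶∃¬ k (λ j → isOld (φ j) ≡ true) (λ j → isOld (φ j) Bool.≟ true) (λ allOld → free (pullback allOld)))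
    where
    pullback : (∀ j → isOld (φ j) ≡ true) → Contains F H₀
    pullback allOld = ψ , ψ-injective , ψ-edge
      where
      ψ : Fin k → Fin n
      ψ j = proj₁ (old-index (φ j) (allOld j))
      ψ↑ˡ : ∀ j → ψ j ↑ˡ a ≡ φ j
      ψ↑ˡ j = proj₂ (old-index (φ j) (allOld j))
      ψ-injective : ∀ {j j′} → ψ j ≡ ψ j′ → j ≡ j′
      ψ-injective {j} {j′} eq = φ-injective (trans (sym (ψ↑ˡ j)) (trans (cong (_↑ˡ a) eq) (ψ↑ˡ j′)))
      ψ-edge : ∀ x y z → edge F x y z ≡ true → edge H₀ (ψ x) (ψ y) (ψ z) ≡ true
      ψ-edge x y z e rewrite sym (edge-↑ˡ (ψ x) (ψ y) (ψ z)) | ψ↑ˡ x | ψ↑ˡ y | ψ↑ˡ z = φ-edge x y z e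

  padded-noFactor : ∀ {k} {F : ThreeGraph k} → FFree F H₀ → a * k < n + a → ¬ HasFactor F padded
  padded-noFactor {k} {F} free ak<N f@(m , φ , embedded , disjoint , _) =
    ℕ.<-irrefl refl (ℕ.≤-<-trans (factor-covers {F = F} {H = padded} f) (ℕ.≤-<-trans (ℕ.*-monoˡ-≤ k copies-≤) ak<N))
    where
    newPosition : Fin m → Fin k
    newPosition i = proj₁ (copy-meets-new {F = F} free (embedded i))
    newVertex : Fin m → Fin a
    newVertex i = proj₁ (new-index (φ i (newPosition i)) (proj₂ (copy-meets-new {F = F} free (embedded i))))
    newVertex-↑ʳ : ∀ i → n ↑ʳ newVertex i ≡ φ i (newPosition i)
    newVertex-↑ʳ i = proj₂ (new-index (φ i (newPosition i)) (proj₂ (copy-meets-new {F = F} free (embedded i))))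
    newVertex-injective : ∀ {i i′} → newVertex i ≡ newVertex i′ → i ≡ i′
    newVertex-injective {i} {i′} eq = proj₁ (disjoint i _ i′ _
      (trans (sym (newVertex-↑ʳ i)) (trans (cong (n ↑ʳ_) eq) (newVertex-↑ʳ i′))))
    copies-≤ : m ≤ a
    copies-≤ = injective⇒≤ newVertex-injective

  restrict : Subset (n + a) → Subset n
  restrict X = tabulate (λ i → lookup X (i ↑ˡ a))

  module _ (X₁ X₂ X₃ : Subset (n + a)) where

    private
      allOld : Fin (n + a) → Fin (n + a) → Fin (n + a) → Bool
      allOld x y z = isOld x ∧ isOld y ∧ isOld z

      inBox : Fin (n + a) → Fin (n + a) → Fin (n + a) → ℕ
      inBox x y z = 𝟙 (lookup X₁ x) * 𝟙 (lookup X₂ y) * 𝟙 (lookup X₃ z)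

      inBoxEdge : Fin (n + a) → Fin (n + a) → Fin (n + a) → ℕ
      inBoxEdge x y z = 𝟙 (boxedEdge (lookup X₁ x) (lookup X₂ y) (lookup X₃ z) (edge padded x y z))

      lookup-restrict : ∀ X i → lookup (restrict X) i ≡ lookup X (i ↑ˡ a)
      lookup-restrict X = lookup∘tabulate (λ i → lookup X (i ↑ˡ a))

    boxNotOld : ℕ
    boxNotOld = Σ³ (n + a) (λ x y z → 𝟙 (not (allOld x y z)) * inBox x y z)

    box-split : ∣ X₁ ∣ * ∣ X₂ ∣ * ∣ X₃ ∣ ≡ ∣ restrict X₁ ∣ * ∣ restrict X₂ ∣ * ∣ restrict X₃ ∣ + boxNotOld
    box-split = begin
      ∣ X₁ ∣ * ∣ X₂ ∣ * ∣ X₃ ∣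
        ≡⟨ ∣∣³≡Σ³ (n + a) X₁ X₂ X₃ ⟩
      Σ³ (n + a) inBox
        ≡⟨ Σ³-cong (n + a) (λ x y z → sym (𝟙-split (allOld x y z) (inBox x y z))) ⟩
      Σ³ (n + a) (λ x y z → 𝟙 (allOld x y z) * inBox x y z + 𝟙 (not (allOld x y z)) * inBox x y z)
        ≡⟨ Σ³-+ (n + a) _ _ ⟩
      Σ³ (n + a) (λ x y z → 𝟙 (allOld x y z) * inBox x y z) + boxNotOld
        ≡⟨ cong (_+ boxNotOld) (Σ³-isOld inBox) ⟩
      Σ³ n (λ i j l → inBox (i ↑ˡ a) (j ↑ˡ a) (l ↑ˡ a)) + boxNotOld
        ≡⟨ cong (_+ boxNotOld) (sym (trans (∣∣³≡Σ³ n (restrict X₁) (restrict X₂) (restrict X₃))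
             (Σ³-cong n λ i j l → cong₂ _*_ (cong₂ _*_ (cong 𝟙 (lookup-restrict X₁ i)) (cong 𝟙 (lookup-restrict X₂ j))) (cong 𝟙 (lookup-restrict X₃ l))))) ⟩
      ∣ restrict X₁ ∣ * ∣ restrict X₂ ∣ * ∣ restrict X₃ ∣ + boxNotOld ∎
      where open ≡-Reasoning

    tripleCount-split-≤ : tripleCount H₀ (restrict X₁) (restrict X₂) (restrict X₃) + boxNotOld
                            ≤ tripleCount padded X₁ X₂ X₃ + 3 * ((n + a) * (n + a))
    tripleCount-split-≤ = begin
      tripleCount H₀ (restrict X₁) (restrict X₂) (restrict X₃) + boxNotOld
        ≡⟨ cong (_+ boxNotOld) (trans (Σ³-cong n restricted-inBoxEdge) (sym (Σ³-isOld inBoxEdge))) ⟩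
      Σ³ (n + a) (λ x y z → 𝟙 (allOld x y z) * inBoxEdge x y z) + boxNotOld
        ≡⟨ Σ³-+ (n + a) _ _ ⟨
      Σ³ (n + a) (λ x y z → 𝟙 (allOld x y z) * inBoxEdge x y z + 𝟙 (not (allOld x y z)) * inBox x y z)
        ≤⟨ Σ³-mono-≤ (n + a) (λ x y z → boxedEdge-split-≤ (allOld x y z) (lookup X₁ x) (lookup X₂ y) (lookup X₃ z)
                                          (edge padded x y z) (coincident x y z) (edge-notAllOld x y z)) ⟩
      Σ³ (n + a) (λ x y z → inBoxEdge x y z + 𝟙 (coincident x y z))
        ≡⟨ Σ³-+ (n + a) _ _ ⟩
      tripleCount padded X₁ X₂ X₃ + Σ³ (n + a) (λ x y z → 𝟙 (coincident x y z))
        ≤⟨ ℕ.+-monoʳ-≤ (tripleCount padded X₁ X₂ X₃) (Σ³-coincident-≤ (n + a)) ⟩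
      tripleCount padded X₁ X₂ X₃ + 3 * ((n + a) * (n + a)) ∎
      where
      open ℕ.≤-Reasoning
      restricted-inBoxEdge : ∀ i j l →
        𝟙 (boxedEdge (lookup (restrict X₁) i) (lookup (restrict X₂) j) (lookup (restrict X₃) l) (edge H₀ i j l))
          ≡ inBoxEdge (i ↑ˡ a) (j ↑ˡ a) (l ↑ˡ a)
      restricted-inBoxEdge i j l
        rewrite lookup-restrict X₁ i | lookup-restrict X₂ j | lookup-restrict X₃ l | edge-↑ˡ i j l = refl

  padded-dense : ∀ {p p′ μ μ′} → IsDense H₀ p μ → ℚ.0ℚ ℚ.≤ p′ → p′ ℚ.≤ p → p′ ℚ.≤ ℚ.1ℚ →
    μ ℚ.* ℕtoℚ (n ^ 3) ℚ.+ ℕtoℚ (3 * ((n + a) * (n + a))) ℚ.≤ μ′ ℚ.* ℕtoℚ ((n + a) ^ 3) →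
    IsDense padded p′ μ′
  padded-dense {p} {p′} {μ} {μ′} dense₀ 0≤p′ p′≤p p′≤1 budget X₁ X₂ X₃ =
    subst (λ q → q ℚ.- μ′ ℚ.* ℕtoℚ ((n + a) ^ 3) ℚ.≤ ℕtoℚ (tripleCount padded X₁ X₂ X₃))
          (sym (*-ℕtoℚ³ p′ (∣ X₁ ∣) (∣ X₂ ∣) (∣ X₃ ∣)))
          (padding-density-bound p p′ μ μ′ (∣ X₁ ∣ * ∣ X₂ ∣ * ∣ X₃ ∣) (∣ Y₁ ∣ * ∣ Y₂ ∣ * ∣ Y₃ ∣) (boxNotOld X₁ X₂ X₃)
             (tripleCount padded X₁ X₂ X₃) (tripleCount H₀ Y₁ Y₂ Y₃) (3 * ((n + a) * (n + a))) (n ^ 3) ((n + a) ^ 3)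
             0≤p′ p′≤p p′≤1 (box-split X₁ X₂ X₃) (tripleCount-split-≤ X₁ X₂ X₃) restricted-dense budget)
    where
    Y₁ Y₂ Y₃ : Subset n
    Y₁ = restrict X₁
    Y₂ = restrict X₂
    Y₃ = restrict X₃
    restricted-dense : p ℚ.* ℕtoℚ (∣ Y₁ ∣ * ∣ Y₂ ∣ * ∣ Y₃ ∣) ℚ.- μ ℚ.* ℕtoℚ (n ^ 3) ℚ.≤ ℕtoℚ (tripleCount H₀ Y₁ Y₂ Y₃)
    restricted-dense = subst (λ q → q ℚ.- μ ℚ.* ℕtoℚ (n ^ 3) ℚ.≤ ℕtoℚ (tripleCount H₀ Y₁ Y₂ Y₃))
                             (*-ℕtoℚ³ p (∣ Y₁ ∣) (∣ Y₂ ∣) (∣ Y₃ ∣)) (dense₀ Y₁ Y₂ Y₃)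

PaddingSize : ℕ → ℕ → ℕ → Set
PaddingSize k n a = (k ∣ n + a) × (a * k < n + a) × (∀ c → a ≤ c + 2 → n + a ≤ (k + k) * c)

-- With k = d + 2 and n = r + q (d + 1), where q = 2r + 2d + 7 + f, the total n + a is
-- (2r + 2d + 6 + f) k; a codegree of at least a - 2 = r + d + 3 + f is then half of that total.
paddingSize-of-quotient : ∀ d r f → PaddingSize (suc (suc d)) (r + (2 * r + 2 * d + 7 + f) * suc d) (r + d + 5 + f)
paddingSize-of-quotient d r f = (divides (2 * r + 2 * d + 6 + f) total≡) , ak<total , total≤
  where
  open +-*-Solver
  n = r + (2 * r + 2 * d + 7 + f) * suc d
  a = r + d + 5 + f
  k = suc (suc d)
  total≡ : n + a ≡ (2 * r + 2 * d + 6 + f) * k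
  total≡ = solve 3 (λ r d f → (r :+ (con 2 :* r :+ con 2 :* d :+ con 7 :+ f) :* (con 1 :+ d)) :+ (r :+ d :+ con 5 :+ f)
                           := (con 2 :* r :+ con 2 :* d :+ con 6 :+ f) :* (con 2 :+ d)) refl r d f
  ak<total : a * k < n + a
  ak<total = ℕ.≤-trans (ℕ.m≤m+n (suc (a * k)) ((r + d) * k + suc d)) (ℕ.≤-reflexive (sym (trans total≡ regroup)))
    where
    regroup : (2 * r + 2 * d + 6 + f) * k ≡ suc (a * k) + ((r + d) * k + suc d)
    regroup = solve 3 (λ r d f → (con 2 :* r :+ con 2 :* d :+ con 6 :+ f) :* (con 2 :+ d)
                              := (con 1 :+ (r :+ d :+ con 5 :+ f) :* (con 2 :+ d)) :+ ((r :+ d) :* (con 2 :+ d) :+ (con 1 :+ d))) refl r d f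
  total≤ : ∀ c → a ≤ c + 2 → n + a ≤ (k + k) * c
  total≤ c a≤c+2 = ℕ.≤-trans (ℕ.m≤m+n (n + a) (k * (f + 2 * g))) (ℕ.≤-reflexive (sym (trans (cong ((k + k) *_) c≡) regroup)))
    where
    c₀ = r + d + 3 + f
    c₀≤c : c₀ ≤ c
    c₀≤c = ℕ.+-cancelʳ-≤ 2 c₀ c (ℕ.≤-trans (ℕ.≤-reflexive (solve 3 (λ r d f → (r :+ d :+ con 3 :+ f) :+ con 2 := r :+ d :+ con 5 :+ f) refl r d f)) a≤c+2)
    g = c ∸ c₀
    c≡ : c ≡ c₀ + g
    c≡ = sym (ℕ.m+[n∸m]≡n c₀≤c)
    regroup : (k + k) * (c₀ + g) ≡ n + a + k * (f + 2 * g)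
    regroup = trans (solve 4 (λ r d f g → ((con 2 :+ d) :+ (con 2 :+ d)) :* ((r :+ d :+ con 3 :+ f) :+ g)
                                     := (con 2 :* r :+ con 2 :* d :+ con 6 :+ f) :* (con 2 :+ d) :+ (con 2 :+ d) :* (f :+ con 2 :* g)) refl r d f g)
                    (cong (_+ k * (f + 2 * g)) (sym total≡))

paddingSize-exists : ∀ d n → (4 * d + 7) * suc d ≤ n → ∃ (PaddingSize (suc (suc d)) n)
paddingSize-exists d n large = r + d + 5 + f , subst (λ m → PaddingSize (suc (suc d)) m (r + d + 5 + f)) (sym n≡) (paddingSize-of-quotient d r f)
  where
  r = n % suc d
  q = n / suc d
  q-large : 2 * r + 2 * d + 7 ≤ q
  q-large = begin
    2 * r + 2 * d + 7             ≤⟨ ℕ.+-monoˡ-≤ 7 (ℕ.+-monoˡ-≤ (2 * d) (ℕ.*-monoʳ-≤ 2 (ℕ.≤-pred (m%n<n n (suc d))))) ⟩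
    2 * d + 2 * d + 7             ≡⟨ solve 1 (λ d → con 2 :* d :+ con 2 :* d :+ con 7 := con 4 :* d :+ con 7) refl d ⟩
    4 * d + 7                     ≡⟨ sym (m*n/n≡m (4 * d + 7) (suc d)) ⟩
    (4 * d + 7) * suc d / suc d   ≤⟨ /-monoˡ-≤ (suc d) large ⟩
    q                             ∎
    where
    open ℕ.≤-Reasoning
    open +-*-Solver
  f = q ∸ (2 * r + 2 * d + 7)
  n≡ : n ≡ r + (2 * r + 2 * d + 7 + f) * suc d
  n≡ = trans (m≡m%n+[m/n]*n n (suc d)) (cong (λ x → r + x * suc d) (sym (ℕ.m+[n∸m]≡n q-large)))

order≤1-∉PiSet : ∀ {k} (F : ThreeGraph k) {p} → k ≤ 1 → ¬ InPiSet F p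
order≤1-∉PiSet F k≤1 (_ , _ , piSet) = case piSet ℚ.1ℚ (ℚ.positive⁻¹ ℚ.1ℚ) 1 of λ where
  (suc _ , H , F-free , _ , _) → F-free (contains-order≤1 F H k≤1)

-- FACTOR only constrains densities below 1, hence the padded graph is tested at p/2.
positive-∉PiSet : ∀ {d} (F : ThreeGraph (suc (suc d))) {p} → InFACTOR F → InPiSet F p → ¬ (ℚ.0ℚ ℚ.< p)
positive-∉PiSet {d} F {p} factorF (0≤p , p≤1 , piSet) 0<p =
  let n₀ , μ′ , 0<μ′ , factorable = factorF (p ℚ.* ℚ.½) α (half-pos 0<p) (half-<1 p≤1) (1/suc-pos _) (1/suc-<1 _)
      M , 1≤μ′M = archimedean μ′ 0<μ′
      n , H₀ , H₀-free , H₀-dense , n-large = piSet (μ′ ℚ.* ℚ.½) (half-pos 0<μ′) (n₀ + 6 * M + (4 * d + 7) * suc d)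
      a , k∣N , ak<N , codeg-large = paddingSize-exists d n (ℕ.m+n≤o⇒n≤o (n₀ + 6 * M) n-large)
      n≤N : n ≤ n + a
      n≤N = ℕ.m≤m+n n a
      open Padded H₀ a
      dense : IsDense padded (p ℚ.* ℚ.½) μ′
      dense = padded-dense {μ = μ′ ℚ.* ℚ.½} {μ′ = μ′} H₀-dense (ℚ.<⇒≤ (half-pos 0<p)) (half-≤ 0≤p) (ℚ.<⇒≤ (half-<1 p≤1))
                (cube-budget μ′ n (n + a) M (ℚ.<⇒≤ 0<μ′) n≤N 1≤μ′M
                   (ℕ.≤-trans (ℕ.m+n≤o⇒n≤o n₀ (ℕ.m+n≤o⇒m≤o _ n-large)) n≤N))
      codeg-≥ : MinCodegAtLeast padded α
      codeg-≥ u v u≢v = 1/suc-*-≤ _ (codeg padded u v) (n + a) (codeg-large (codeg padded u v) (padded-codeg u v u≢v))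
      n₀≤N : n₀ ≤ n + a
      n₀≤N = ℕ.≤-trans (ℕ.m+n≤o⇒m≤o n₀ (ℕ.m+n≤o⇒m≤o _ n-large)) n≤N
  in padded-noFactor {F = F} H₀-free ak<N (factorable (n + a) padded dense codeg-≥ n₀≤N k∣N)
  where
  α = 1/suc (suc d + suc (suc d))   -- 1/(2k)

lemma7p2 : ∀ {k : ℕ} (F : ThreeGraph k) → InFACTOR F → PiZero F
lemma7p2 {zero}        F _       p p∈PiSet = ⊥-elim (order≤1-∉PiSet F ℕ.z≤n p∈PiSet)
lemma7p2 {suc zero}    F _       p p∈PiSet = ⊥-elim (order≤1-∉PiSet F ℕ.≤-refl p∈PiSet)
lemma7p2 {suc (suc d)} F factorF p p∈PiSet = ℚ.≮⇒≥ (positive-∉PiSet F factorF p∈PiSet)
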